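{- There exists $T\subseteq\omega^{<\omega}$ with $T\in\mathsf{HC}^+$ such that $\mathsf{nwd}\le_K\mathsf{HC}\restriction T$.
   Context: For $r\in\omega^\omega$, $H_r=\{s\in\omega^{<\omega}: s(i)\ne r(i)\text{ for all } i<|s|\}$; $\mathsf{HC}$ is the ideal on $\omega^{<\omega}$ generated by $\{H_r:r\in\omega^\omega\}$; $\mathsf{HC}^+$ is the family of subsets of $\omega^{<\omega}$ not in $\mathsf{HC}$, and $\mathsf{HC}\restriction T=\{B\subseteq T:B\in\mathsf{HC}\}$. $\mathsf{nwd}$ is the ideal on $2^{<\omega}$ of all $N$ such that for every $s\in 2^{<\omega}$ there is $t\supseteq s$ such that no element of $N$ extends $t$. For ideals $\mathcal{I}$ on $A$, $\mathcal{J}$ on $B$, $\mathcal{I}\le_K\mathcal{J}$ means there is $\varphi:B\to A$ with $\varphi^{ -1}[C]\in\mathcal{J}$ for all $C\in\mathcal{I}$. -}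

module Defs where

open import Level using (Level; suc; zero)
open import Data.Nat using (ℕ; _<_)
open import Data.Bool using (Bool)
open import Data.List using (List; length; lookup; _++_)
open import Data.List.Relation.Unary.Any using (Any)
open import Data.Fin using (Fin; toℕ)
open import Data.Product using (Σ; ∃; _×_)
open import Relation.Binary.PropositionalEquality using (_≡_; _≢_)
open import Relation.Nullary using (¬_)

-- ω^{<ω} is List ℕ, 2^{<ω} is List Bool.
-- A subset of a set A is a predicate A → Set.
Subset : Set → Set₁
Subset A = A → Set

_⊑_ : {A : Set} → List A → List A → Set
s ⊑ t = ∃ λ w → s ++ w ≡ t

H : (ℕ → ℕ) → Subset (List ℕ)
H r s = (i : Fin (length s)) → lookup s i ≢ r (toℕ i)

HC : Subset (List ℕ) → Set
HC B = ∃ λ (rs : List (ℕ → ℕ)) → ∀ s → B s → Any (λ r → H r s) rs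

HC⁺ : Subset (List ℕ) → Set
HC⁺ B = ¬ HC B

HC↾ : Subset (List ℕ) → Subset (List ℕ) → Set
HC↾ T B = (∀ s → B s → T s) × HC B

nwd : Subset (List Bool) → Set
nwd N = ∀ s → ∃ λ t → s ⊑ t × (∀ u → t ⊑ u → ¬ N u)

nwd≤K-HC↾ : Subset (List ℕ) → Set₁
nwd≤K-HC↾ T =
  Σ ((s : List ℕ) → T s → List Bool) λ φ →
    (C : Subset (List Bool)) → nwd C →
      HC↾ T (λ s → Σ (T s) λ t → C (φ s t))

-- Read a sequence s ∈ ω^{<ω} as instructions for growing a binary string: the letter 0 does
-- nothing, the letter m + 1 appends the m-th binary string, and T only admits a nonzero letter
-- at a position i when the string built so far has length at most i. The map φ sends s to the
-- string it builds.
-- T is HC-positive: given finitely many r, we can meet them one after the other, padding with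
-- zeros until the position catches up with the length of the current string.
-- If C is nowhere dense, fix for each j a string w_j such that u w_j has no extension in C for
-- every u of length ≤ j, and let r(j) be the letter appending w_j. Any s ∈ T meeting r at j
-- appends w_j to a string of length ≤ j, so φ(s) ∉ C; hence φ⁻¹[C] ⊆ H_r.
module Submission where

open import Defs
open import Data.List using (List)
open import Data.Nat using (ℕ)
open import Data.Product using (Σ; _×_)

open import Data.Bool using (Bool; true; false)
open import Data.Fin using (Fin; toℕ) renaming (zero to fzero; suc to fsuc)
open import Data.List using ([]; _∷_; [_]; length; lookup; _++_; map; foldl; replicate)
open import Data.List.Membership.Propositional using (_∈_)
open import Data.List.Membership.Propositional.Properties using (∈-map⁺; ∈-++⁺ˡ; ∈-++⁺ʳ)
open import Data.List.Properties using (++-assoc; ++-identityʳ)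
open import Data.List.Relation.Unary.All as All using (All; []; _∷_; lookupAny)
open import Data.List.Relation.Unary.Any using (here; there)
open import Data.Nat using (zero; suc; _+_; _≤_; s≤s)
open import Data.Nat.Binary using (ℕᵇ; 2[1+_]; 1+[2_]) renaming (zero to 0ᵇ; toℕ to ℕᵇ→ℕ; fromℕ to ℕ→ℕᵇ)
open import Data.Nat.Binary.Properties using (fromℕ-toℕ)
open import Data.Nat.Properties using (+-suc; +-identityʳ; m≤m+n)
open import Data.Product using (_,_; proj₁; proj₂; ∃)
open import Data.Unit using (⊤; tt)
open import Relation.Binary.PropositionalEquality using (_≡_; refl; sym; trans; cong; subst)
open import Relation.Nullary using (¬_)

bits : ℕᵇ → List Bool
bits 0ᵇ       = []
bits 2[1+ x ] = true ∷ bits x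
bits 1+[2 x ] = false ∷ bits x

fromBits : List Bool → ℕᵇ
fromBits []          = 0ᵇ
fromBits (true ∷ w)  = 2[1+ fromBits w ]
fromBits (false ∷ w) = 1+[2 fromBits w ]

bits-fromBits : ∀ w → bits (fromBits w) ≡ w
bits-fromBits []          = refl
bits-fromBits (true ∷ w)  = cong (true ∷_) (bits-fromBits w)
bits-fromBits (false ∷ w) = cong (false ∷_) (bits-fromBits w)

decode : ℕ → List Bool
decode n = bits (ℕ→ℕᵇ n)

encode : List Bool → ℕ
encode w = ℕᵇ→ℕ (fromBits w)

decode-encode : ∀ w → decode (encode w) ≡ w
decode-encode w = trans (cong bits (fromℕ-toℕ (fromBits w))) (bits-fromBits w)

⊑-refl : ∀ (u : List Bool) → u ⊑ u
⊑-refl u = [] , ++-identityʳ u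

⊑-trans : ∀ {s t u : List Bool} → s ⊑ t → t ⊑ u → s ⊑ u
⊑-trans {s} (v , refl) (w , refl) = v ++ w , sym (++-assoc s v w)

extend : List Bool → ℕ → List Bool
extend u zero    = u
extend u (suc m) = u ++ decode m

build : List Bool → List ℕ → List Bool
build = foldl extend

⊑-extend : ∀ u v → u ⊑ extend u v
⊑-extend u zero    = ⊑-refl u
⊑-extend u (suc m) = decode m , refl

⊑-build : ∀ u s → u ⊑ build u s
⊑-build u []      = ⊑-refl u
⊑-build u (v ∷ s) = ⊑-trans (⊑-extend u v) (⊑-build (extend u v) s)

Admissible : List Bool → ℕ → List ℕ → Set
Admissible u i []          = ⊤
Admissible u i (zero ∷ s)  = Admissible u (suc i) s
Admissible u i (suc m ∷ s) = length u ≤ i × Admissible (u ++ decode m) (suc i) s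

admissible : Subset (List ℕ)
admissible = Admissible [] 0

Admissible-∷ : ∀ {u i s} v → length u ≤ i → Admissible (extend u v) (suc i) s →
               Admissible u i (v ∷ s)
Admissible-∷ zero    _ adm = adm
Admissible-∷ (suc m) p adm = p , adm

Admissible-pad : ∀ {u i s} n → Admissible u (n + i) s → Admissible u i (replicate n 0 ++ s)
Admissible-pad         zero    adm = adm
Admissible-pad {u} {i} {s} (suc n) adm =
  Admissible-pad n (subst (λ k → Admissible u k s) (sym (+-suc n i)) adm)

data Agrees (r : ℕ → ℕ) : ℕ → List ℕ → Set where
  here  : ∀ {i v s} → v ≡ r i → Agrees r i (v ∷ s)
  there : ∀ {i v s} → Agrees r (suc i) s → Agrees r i (v ∷ s)

Agrees-pad : ∀ {r i s} n → Agrees r (n + i) s → Agrees r i (replicate n 0 ++ s)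
Agrees-pad         zero    a = a
Agrees-pad {r} {i} {s} (suc n) a =
  there (Agrees-pad n (subst (λ k → Agrees r k s) (sym (+-suc n i)) a))

lookup⇒Agrees : ∀ {r} i s (k : Fin (length s)) → lookup s k ≡ r (i + toℕ k) → Agrees r i s
lookup⇒Agrees {r} i (v ∷ s) fzero    eq = here (trans eq (cong r (+-identityʳ i)))
lookup⇒Agrees {r} i (v ∷ s) (fsuc k) eq =
  there (lookup⇒Agrees (suc i) s k (trans eq (cong r (+-suc i (toℕ k)))))

Agrees⇒lookup : ∀ {r i s} → Agrees r i s → ∃ λ (k : Fin (length s)) → lookup s k ≡ r (i + toℕ k)
Agrees⇒lookup {r} {i} (here eq) = fzero , trans eq (cong r (sym (+-identityʳ i)))
Agrees⇒lookup {r} {i} (there a) with Agrees⇒lookup a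
... | k , eq = fsuc k , trans eq (cong r (sym (+-suc i (toℕ k))))

Agrees⇒¬H : ∀ {r s} → Agrees r 0 s → ¬ H r s
Agrees⇒¬H a h with Agrees⇒lookup a
... | k , eq = h k eq

meetAll : List (ℕ → ℕ) → List Bool → ℕ → List ℕ
meetAll []       u i = []
meetAll (r ∷ rs) u i = replicate (length u) 0 ++ r j ∷ meetAll rs (extend u (r j)) (suc j)
  where j = length u + i

meetAll-admissible : ∀ rs u i → Admissible u i (meetAll rs u i)
meetAll-admissible []       u i = tt
meetAll-admissible (r ∷ rs) u i =
  Admissible-pad (length u) (Admissible-∷ (r j) (m≤m+n (length u) i) (meetAll-admissible rs _ _))
  where j = length u + i

meetAll-agrees : ∀ rs u i → All (λ r → Agrees r i (meetAll rs u i)) rs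
meetAll-agrees []       u i = []
meetAll-agrees (r ∷ rs) u i =
  Agrees-pad (length u) (here refl) ∷
  All.map (λ a → Agrees-pad (length u) (there a)) (meetAll-agrees rs _ _)

admissible-positive : HC⁺ admissible
admissible-positive (rs , covers) with
  lookupAny (meetAll-agrees rs [] 0) (covers (meetAll rs [] 0) (meetAll-admissible rs [] 0))
... | agrees , inH = Agrees⇒¬H agrees inH

Safe : Subset (List Bool) → List Bool → Set
Safe C t = ∀ y → t ⊑ y → ¬ C y

Safe-mono : ∀ {C s t} → Safe C s → s ⊑ t → Safe C t
Safe-mono safe s⊑t y t⊑y = safe y (⊑-trans s⊑t t⊑y)

commonSafeExtension : ∀ {C} → nwd C → (L : List (List Bool)) →
                      ∃ λ w → All (λ u → Safe C (u ++ w)) L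
commonSafeExtension E [] = [] , []
commonSafeExtension {C} E (u ∷ L) with commonSafeExtension E L
... | w , safeL with E (u ++ w)
...   | t , (d , u++w++d≡t) , safe-t =
  w ++ d ,
  subst (Safe C) (sym (trans (sym (++-assoc u w d)) u++w++d≡t)) safe-t ∷
  All.map (λ {u′} safe → Safe-mono safe (d , ++-assoc u′ w d)) safeL

stringsUpTo : ℕ → List (List Bool)
stringsUpTo zero    = [ [] ]
stringsUpTo (suc n) = [] ∷ (map (false ∷_) (stringsUpTo n) ++ map (true ∷_) (stringsUpTo n))

∈-stringsUpTo : ∀ n u → length u ≤ n → u ∈ stringsUpTo n
∈-stringsUpTo zero    []          _       = here refl
∈-stringsUpTo (suc n) []          _       = here refl
∈-stringsUpTo (suc n) (false ∷ u) (s≤s p) =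
  there (∈-++⁺ˡ (∈-map⁺ (false ∷_) (∈-stringsUpTo n u p)))
∈-stringsUpTo (suc n) (true ∷ u)  (s≤s p) =
  there (∈-++⁺ʳ (map (false ∷_) (stringsUpTo n)) (∈-map⁺ (true ∷_) (∈-stringsUpTo n u p)))

module NowhereDense {C : Subset (List Bool)} (E : nwd C) where

  escape : ℕ → List Bool
  escape n = proj₁ (commonSafeExtension E (stringsUpTo n))

  escape-safe : ∀ {n u} → length u ≤ n → Safe C (u ++ escape n)
  escape-safe {n} {u} p = All.lookup (proj₂ (commonSafeExtension E (stringsUpTo n))) (∈-stringsUpTo n u p)

  escaping : ℕ → ℕ
  escaping n = suc (encode (escape n))

  Agrees⇒safe : ∀ i u s → Admissible u i s → Agrees escaping i s → Safe C (build u s)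
  Agrees⇒safe i u (_ ∷ s) (p , _) (here refl) =
    Safe-mono (subst (λ w → Safe C (u ++ w)) (sym (decode-encode (escape i))) (escape-safe p))
              (⊑-build _ s)
  Agrees⇒safe i u (zero ∷ s)  adm       (there a) = Agrees⇒safe (suc i) u s adm a
  Agrees⇒safe i u (suc m ∷ s) (_ , adm) (there a) = Agrees⇒safe (suc i) (u ++ decode m) s adm a

  preimage⊆H : ∀ s → admissible s → C (build [] s) → H escaping s
  preimage⊆H s adm c k eq = Agrees⇒safe 0 [] s adm (lookup⇒Agrees 0 s k eq) _ (⊑-refl _) c

mainTheorem15 : Σ (Subset (List ℕ)) λ T → HC⁺ T × nwd≤K-HC↾ T
mainTheorem15 =
  admissible , admissible-positive ,
  (λ s _ → build [] s) ,
  λ C E → (λ _ → proj₁) ,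
          (NowhereDense.escaping E ∷ [] , λ s (adm , c) → here (NowhereDense.preimage⊆H E s adm c))
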